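{- Let $G$ be a finite graph such that, when Tron is played rationally on $G$, $\left(\mathcal{B}/\mathcal{A}\right)_G < 1$. Let $H$ be the graph obtained from $G$ by deleting the vertex at which Alice starts (under rational play on $G$). Then, with Tron played rationally on $H$, $$\left(\frac{\mathcal{B}+1}{\mathcal{A}}\right)_{H} \geq \left(\frac{\mathcal{A}}{\mathcal{B}}\right)_{G}.$$
   Context: Tron on an undirected graph $G$ is a two-player game with complete information. The first player (Alice) picks a start vertex; then the second player (Bob) picks a different start vertex. The players then alternate turns, Alice first; in a turn a player moves from his or her current vertex to an adjacent vertex that has not yet been visited by either player (start vertices count as visited). A player with no legal move is skipped, and the game ends when neither player can move. $\mathcal{A}$ and $\mathcal{B}$ denote the numbers of vertices traversed (including the start vertex) by Alice and Bob respectively, and the outcome of the game is $\mathcal{B}/\mathcal{A}$. Rational play means Bob plays to maximize the outcome and Alice plays to minimize it; $(\cdot)_G$ denotes the value of the quantity when both play rationally on $G$. -}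

module Defs where

open import Data.Nat using (ℕ; zero; suc)
open import Data.Bool using (Bool; true; false; _∧_; _∨_; not)
open import Data.Fin using (Fin; punchIn; _≟_)
open import Data.List using (List; []; _∷_; foldr; filterᵇ; allFin)
open import Data.Integer using (+_; ∣_∣)
open import Data.Rational using (ℚ; _/_; _⊓_; _⊔_; 0ℚ; ↥_; ↧ₙ_)
open import Relation.Nullary using (does)
open import Relation.Binary.PropositionalEquality using (_≡_)

-- Finite undirected graphs on the vertex set Fin n
-- (adjacency as a symmetric Boolean relation; loops, if any, are
--  irrelevant for Tron since a player's current vertex is visited).

record Graph (n : ℕ) : Set where
  field
    adj : Fin n → Fin n → Bool
    adj-sym : ∀ u v → adj u v ≡ adj v u
open Graph public

deleteVertex : ∀ {n} → Graph (suc n) → Fin (suc n) → Graph n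
deleteVertex G a = record
  { adj = λ i j → adj G (punchIn a i) (punchIn a j)
  ; adj-sym = λ i j → adj-sym G (punchIn a i) (punchIn a j) }

-- Rationals p/q (q is always ≥ 1 when used; q = 0 gives 0 by convention)

frac : ℕ → ℕ → ℚ
frac p zero    = 0ℚ
frac p (suc q) = (+ p) / suc q

recip : ℚ → ℚ
recip q = frac (↧ₙ q) ∣ ↥ q ∣

-- minimum / maximum of g over a nonempty list (empty list: 0, never used)
minOver : ∀ {A : Set} → (A → ℚ) → List A → ℚ
minOver g []       = 0ℚ
minOver g (x ∷ xs) = foldr (λ y acc → g y ⊓ acc) (g x) xs

maxOver : ∀ {A : Set} → (A → ℚ) → List A → ℚ
maxOver g []       = 0ℚ
maxOver g (x ∷ xs) = foldr (λ y acc → g y ⊔ acc) (g x) xs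

data Turn : Set where
  alice bob : Turn

Visited : ℕ → Set
Visited n = Fin n → Bool

mark : ∀ {n} → Fin n → Visited n → Visited n
mark w vis u = does (u ≟ w) ∨ vis u

moves : ∀ {n} → Graph n → Visited n → Fin n → List (Fin n)
moves G vis v = filterᵇ (λ w → adj G v w ∧ not (vis w)) (allFin _)

-- Payoff : a function of (𝒜, ℬ) at the end of the game.
Payoff : Set
Payoff = ℕ → ℕ → ℚ

-- Minimax value of the position (whose turn, visited set, Alice's and
-- Bob's current vertices, counts 𝒜 and ℬ so far), Alice minimizing and
-- Bob maximizing the payoff. A player with no legal move is skipped;
-- the game ends when neither can move. The first argument is fuel;
-- every move visits a new vertex, so fuel n never runs out on Fin n.
val : ∀ {n} → Graph n → Payoff → ℕ → Turn → Visited n →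
      Fin n → Fin n → ℕ → ℕ → ℚ
val G f zero    t vis pa pb A B = f A B
val G f (suc k) t vis pa pb A B = pick t (moves G vis pa) (moves G vis pb)
  where
  goA : _ → ℚ
  goA w = val G f k bob (mark w vis) w pb (suc A) B
  goB : _ → ℚ
  goB w = val G f k alice (mark w vis) pa w A (suc B)
  pick : Turn → List _ → List _ → ℚ
  pick alice (w ∷ ws) _        = minOver goA (w ∷ ws)
  pick alice []       (w ∷ ws) = maxOver goB (w ∷ ws)
  pick bob   _        (w ∷ ws) = maxOver goB (w ∷ ws)
  pick bob   (w ∷ ws) []       = minOver goA (w ∷ ws)
  pick _     []       []       = f A B

playFrom : ∀ {n} → Graph n → Payoff → Fin n → Fin n → ℚ
playFrom {n} G f a b = val G f n alice (mark a (mark b (λ _ → false))) a b 1 1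

startValue : ∀ {n} → Graph n → Payoff → Fin n → ℚ
startValue G f a =
  maxOver (playFrom G f a) (filterᵇ (λ b → not (does (b ≟ a))) (allFin _))

gameValue : ∀ {n} → Graph n → Payoff → ℚ
gameValue G f = minOver (startValue G f) (allFin _)

B/A : Payoff
B/A A B = frac B A

[B+1]/A : Payoff
[B+1]/A A B = frac (suc B) A

RationalAliceStart : ∀ {n} → Graph n → Payoff → Fin n → Set
RationalAliceStart G f a = ∀ a' → startValue G f a Data.Rational.≤ startValue G f a'

module Submission where

-- Let a be Alice's rational start on G and H = G - a.  After Alice, having started at a, makes her
-- first move to a vertex z ≠ a of G, the rest of the game lives on the vertices
-- of H (a is visited and can never be entered again).  Reading that game with
-- the roles exchanged -- G's Bob is H's Alice, G's Alice is H's Bob, whose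
-- count lacks the vertex a -- the G-payoff ℬ/𝒜 becomes 𝒜'/(ℬ'+1), the
-- reciprocal of the H-payoff (ℬ'+1)/𝒜'.  Since reciprocation exchanges minima
-- and maxima of positive rationals, the two minimax values are reciprocal
-- position by position ('deletion-duality').
--
-- Given H-Alice's start x, let H-Bob start where G-Alice optimally moves when
-- G-Bob starts at x.  Alice cannot be stuck at a (that would give ℬ ≥ 𝒜 = 1,
-- contradicting (ℬ/𝒜)_G < 1), so this reply y exists, and by duality the H-value
-- from (x, y) is the reciprocal of a G-value that is at most (ℬ/𝒜)_G.

open import Defs
open import Data.Nat using (ℕ; zero; suc; s≤s; z≤n)
open import Data.Fin as F using (Fin; punchIn; punchOut; _≟_)
open import Data.Fin.Properties using (punchIn-injective; punchInᵢ≢i; punchIn-punchOut)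
open import Data.Integer as ℤ using (+_; +[1+_]; -[1+_]; +<+; +≤+)
import Data.Integer.Properties as ℤP
open import Data.Rational using (ℚ; mkℚ; _<_; _≤_; *≤*; *<*; _⊓_; _⊔_; 0ℚ; 1ℚ; fromℚᵘ; toℚᵘ)
open import Data.Rational.Properties
  using ( ≤-refl; ≤-trans; ≤-total; <-irrefl; ≤-<-trans; ⊓-sel; ⊔-sel; ⊓-glb
        ; p≤p⊔q; p≤q⊔p; p≤q⇒p⊓q≡p; p≥q⇒p⊓q≡q; p≤q⇒p⊔q≡q; p≥q⇒p⊔q≡p
        ; normalize-coprime; normalize-pos; positive⁻¹; fromℚᵘ-toℚᵘ; toℚᵘ-fromℚᵘ; fromℚᵘ-cong
        ; 0/n≡0; module ≤-Reasoning )
open import Data.Rational.Unnormalised using (mkℚᵘ; *≡*) renaming (_≃_ to _≃ᵘ_)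
import Data.Nat.Coprimality as Coprime
open import Data.Bool using (Bool; true; false; _∧_; _∨_; not; T)
open import Data.Bool.Properties using (∨-zeroʳ; T-≡; T-∧; T-not-≡)
open import Data.List using (List; []; _∷_; foldr; map; filterᵇ; allFin; tabulate)
open import Data.List.Properties using (map-tabulate; filter-≐)
open import Data.List.Membership.Propositional using (_∈_)
open import Data.List.Membership.Propositional.Properties using (∈-allFin; ∈-filter⁺; ∈-filter⁻)
open import Data.List.Relation.Unary.Any using (here; there)
open import Data.Product using (∃-syntax; _×_; _,_; proj₁; proj₂)
open import Data.Sum using (_⊎_; inj₁; inj₂)
open import Data.Empty using (⊥-elim)
open import Function using (_∘_; Equivalence)
open import Relation.Nullary using (does; yes; no)
open import Relation.Nullary.Decidable using (dec-true; dec-false; T?)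
open import Relation.Binary.PropositionalEquality
open import Algebra.Definitions {A = ℚ} _≡_ using (Selective)

foldOver : ∀ {X : Set} → (ℚ → ℚ → ℚ) → (X → ℚ) → X → List X → ℚ
foldOver _∙_ g w ws = foldr (λ y acc → g y ∙ acc) (g w) ws

module _ {X : Set} where

  foldOver-attained : ∀ {_∙_} → Selective _∙_ → ∀ (g : X → ℚ) w ws →
                      ∃[ z ] z ∈ w ∷ ws × foldOver _∙_ g w ws ≡ g z
  foldOver-attained sel g w [] = w , here refl , refl
  foldOver-attained {_∙_} sel g w (y ∷ ys)
    with sel (g y) (foldOver _∙_ g w ys) | foldOver-attained sel g w ys
  ... | inj₁ e | _                   = y , there (here refl) , e
  ... | inj₂ e | z , here z≡w , e′   = z , here z≡w , trans e e′
  ... | inj₂ e | z , there z∈ , e′   = z , there (there z∈) , trans e e′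

  foldOver-closed : ∀ {_∙_} → Selective _∙_ → (P : ℚ → Set) (g : X → ℚ) →
                    (∀ x → P (g x)) → ∀ w ws → P (foldOver _∙_ g w ws)
  foldOver-closed sel P g Pg w ws with foldOver-attained sel g w ws
  ... | z , _ , e = subst P (sym e) (Pg z)

  foldOver-cong : ∀ _∙_ (g g′ : X → ℚ) → (∀ x → g x ≡ g′ x) →
                  ∀ w ws → foldOver _∙_ g w ws ≡ foldOver _∙_ g′ w ws
  foldOver-cong _∙_ g g′ g≗g′ w []       = g≗g′ w
  foldOver-cong _∙_ g g′ g≗g′ w (v ∷ vs) =
    cong₂ _∙_ (g≗g′ v) (foldOver-cong _∙_ g g′ g≗g′ w vs)

  foldOver-map : ∀ {Y : Set} _∙_ (g : X → ℚ) (h : Y → X) w ws →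
                 foldOver _∙_ g (h w) (map h ws) ≡ foldOver _∙_ (g ∘ h) w ws
  foldOver-map _∙_ g h w []       = refl
  foldOver-map _∙_ g h w (v ∷ vs) = cong (g (h v) ∙_) (foldOver-map _∙_ g h w vs)

  -- A map h turning ∙ into ⋆ on a class P of values commutes with the fold,
  -- provided all folded values lie in P (P then contains every partial fold).
  foldOver-hom : ∀ {_∙_} _⋆_ → Selective _∙_ → (P : ℚ → Set) (h : ℚ → ℚ) →
                 (∀ p q → P p → P q → h (p ∙ q) ≡ h p ⋆ h q) →
                 ∀ (g : X → ℚ) → (∀ x → P (g x)) →
                 ∀ w ws → h (foldOver _∙_ g w ws) ≡ foldOver _⋆_ (h ∘ g) w ws
  foldOver-hom _⋆_ sel P h hom g Pg w []       = refl
  foldOver-hom _⋆_ sel P h hom g Pg w (v ∷ vs) =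
    trans (hom (g v) _ (Pg v) (foldOver-closed sel P g Pg w vs))
          (cong (h (g v) ⋆_) (foldOver-hom _⋆_ sel P h hom g Pg w vs))

  maxOver-upper : ∀ (g : X → ℚ) l {y} → y ∈ l → g y ≤ maxOver g l
  maxOver-upper g (w ∷ ws) = go ws
    where
    go : ∀ ws {y} → y ∈ w ∷ ws → g y ≤ foldOver _⊔_ g w ws
    go []       (here refl)         = ≤-refl
    go (v ∷ vs) (here refl)         = ≤-trans (go vs (here refl)) (p≤q⊔p (g v) _)
    go (v ∷ vs) (there (here refl)) = p≤p⊔q (g v) _
    go (v ∷ vs) (there (there y∈))  = ≤-trans (go vs (there y∈)) (p≤q⊔p (g v) _)

  minOver-greatest : ∀ (g : X → ℚ) {c} → (∀ x → c ≤ g x) → ∀ w ws → c ≤ minOver g (w ∷ ws)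
  minOver-greatest g c≤g w []       = c≤g w
  minOver-greatest g c≤g w (v ∷ vs) = ⊓-glb (c≤g v) (minOver-greatest g c≤g w vs)

recip-mkℚ : ∀ n d .(c : Coprime.Coprime (suc n) (suc d)) →
            recip (mkℚ +[1+ n ] d c) ≡ mkℚ +[1+ d ] n (Coprime.sym c)
recip-mkℚ n d c = normalize-coprime (Coprime.sym c)

recip-antitone : ∀ {p q} → 0ℚ < p → p ≤ q → recip q ≤ recip p
recip-antitone {mkℚ +[1+ a ] da c} {mkℚ +[1+ b ] db c′} _ (*≤* ad≤bd) =
  subst₂ _≤_ (sym (recip-mkℚ b db c′)) (sym (recip-mkℚ a da c))
    (*≤* (subst₂ ℤ._≤_ (ℤP.*-comm +[1+ a ] +[1+ db ]) (ℤP.*-comm +[1+ b ] +[1+ da ]) ad≤bd))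
recip-antitone {mkℚ (+ 0) _ _}     (*<* (+<+ ()))
recip-antitone {mkℚ -[1+ _ ] _ _}  (*<* ())
recip-antitone {mkℚ +[1+ _ ] _ _} {mkℚ (+ 0) _ _}    _ (*≤* (+≤+ ()))
recip-antitone {mkℚ +[1+ _ ] _ _} {mkℚ -[1+ _ ] _ _} _ (*≤* ())

-- Being antitone, recip turns maxima into minima and vice versa.
recip-⊔ : ∀ p q → 0ℚ < p → 0ℚ < q → recip (p ⊔ q) ≡ recip p ⊓ recip q
recip-⊔ p q 0<p 0<q with ≤-total p q
... | inj₁ p≤q = trans (cong recip (p≤q⇒p⊔q≡q p≤q)) (sym (p≥q⇒p⊓q≡q (recip-antitone 0<p p≤q)))
... | inj₂ q≤p = trans (cong recip (p≥q⇒p⊔q≡p q≤p)) (sym (p≤q⇒p⊓q≡p (recip-antitone 0<q q≤p)))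

recip-⊓ : ∀ p q → 0ℚ < p → 0ℚ < q → recip (p ⊓ q) ≡ recip p ⊔ recip q
recip-⊓ p q 0<p 0<q with ≤-total p q
... | inj₁ p≤q = trans (cong recip (p≤q⇒p⊓q≡p p≤q)) (sym (p≥q⇒p⊔q≡p (recip-antitone 0<p p≤q)))
... | inj₂ q≤p = trans (cong recip (p≥q⇒p⊓q≡q q≤p)) (sym (p≤q⇒p⊔q≡q (recip-antitone 0<q q≤p)))

module _ {X : Set} (g : X → ℚ) (0<g : ∀ x → 0ℚ < g x) where

  recip-maxOver : ∀ w ws → recip (maxOver g (w ∷ ws)) ≡ minOver (recip ∘ g) (w ∷ ws)
  recip-maxOver = foldOver-hom _⊓_ ⊔-sel (0ℚ <_) recip recip-⊔ g 0<g

  recip-minOver : ∀ w ws → recip (minOver g (w ∷ ws)) ≡ maxOver (recip ∘ g) (w ∷ ws)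
  recip-minOver = foldOver-hom _⊔_ ⊓-sel (0ℚ <_) recip recip-⊓ g 0<g

frac-positive : ∀ m n → 0ℚ < frac (suc m) (suc n)
frac-positive m n = positive⁻¹ _ {{normalize-pos (suc m) (suc n)}}

-- recip (m/n) ≡ n/m, where both sides are 0 when m = 0.
recip-frac : ∀ m n → recip (frac m (suc n)) ≡ frac (suc n) m
recip-frac zero    n = cong recip (0/n≡0 (suc n))
recip-frac (suc m) n = recip-normalised (frac (suc m) (suc n)) (frac-positive m n)
                         (toℚᵘ-fromℚᵘ (mkℚᵘ +[1+ m ] n))
  where
  recip-normalised : ∀ q → 0ℚ < q → toℚᵘ q ≃ᵘ mkℚᵘ +[1+ m ] n →
                     recip q ≡ fromℚᵘ (mkℚᵘ +[1+ n ] m)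
  recip-normalised (mkℚ +[1+ k ] d c) _ (*≡* kn≡md) =
    trans (recip-mkℚ k d c)
      (trans (sym (fromℚᵘ-toℚᵘ (mkℚ +[1+ d ] k (Coprime.sym c))))
        (fromℚᵘ-cong {mkℚᵘ +[1+ d ] k} {mkℚᵘ +[1+ n ] m}
          (*≡* (trans (ℤP.*-comm +[1+ d ] +[1+ m ]) (trans (sym kn≡md) (ℤP.*-comm +[1+ k ] +[1+ n ]))))))
  recip-normalised (mkℚ (+ 0) _ _)    (*<* (+<+ ()))
  recip-normalised (mkℚ -[1+ _ ] _ _) (*<* ())

one≤frac : ∀ n → 1ℚ ≤ frac (suc n) 1
one≤frac n = subst (1ℚ ≤_) (sym (normalize-coprime (Coprime.sym (Coprime.1-coprimeTo (suc n)))))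
                   (*≤* (+≤+ (s≤s z≤n)))

∈-filterᵇ⁺ : ∀ {X : Set} (p : X → Bool) {x l} → x ∈ l → p x ≡ true → x ∈ filterᵇ p l
∈-filterᵇ⁺ p x∈l px = ∈-filter⁺ (T? ∘ p) x∈l (Equivalence.from T-≡ px)

∈-filterᵇ⁻ : ∀ {X : Set} (p : X → Bool) {x l} → x ∈ filterᵇ p l → T (p x)
∈-filterᵇ⁻ p {l = l} x∈ = proj₂ (∈-filter⁻ (T? ∘ p) {xs = l} x∈)

filterᵇ-cong : ∀ {X : Set} {p q : X → Bool} → (∀ x → p x ≡ q x) → ∀ l → filterᵇ p l ≡ filterᵇ q l
filterᵇ-cong {p = p} {q} p≗q =
  filter-≐ (T? ∘ p) (T? ∘ q) ((λ {x} → subst T (p≗q x)) , λ {x} → subst T (sym (p≗q x)))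

filterᵇ-[]-mono : ∀ {X : Set} (p q : X → Bool) → (∀ x → T (p x) → T (q x)) →
                  ∀ l → filterᵇ q l ≡ [] → filterᵇ p l ≡ []
filterᵇ-[]-mono p q p⇒q []      _ = refl
filterᵇ-[]-mono p q p⇒q (x ∷ l) e with p x in px | q x in qx
... | true  | true  with () ← e
... | true  | false with () ← subst T qx (p⇒q x (subst T (sym px) _))
... | false | true  with () ← e
... | false | false = filterᵇ-[]-mono p q p⇒q l e

filterᵇ-map : ∀ {X Y : Set} (p : X → Bool) (f : Y → X) l →
              filterᵇ p (map f l) ≡ map f (filterᵇ (p ∘ f) l)
filterᵇ-map p f []      = refl
filterᵇ-map p f (y ∷ l) with p (f y)
... | true  = cong (f y ∷_) (filterᵇ-map p f l)
... | false = filterᵇ-map p f l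

filterᵇ-skip : ∀ {X : Set} {m} (a : Fin (suc m)) (h : Fin (suc m) → X) (p : X → Bool) →
               p (h a) ≡ false → filterᵇ p (tabulate h) ≡ filterᵇ p (tabulate (h ∘ punchIn a))
filterᵇ-skip F.zero h p pha with p (h F.zero)
... | false = refl
filterᵇ-skip {m = suc m} (F.suc a) h p pha with p (h F.zero)
... | true  = cong (h F.zero ∷_) (filterᵇ-skip a (h ∘ F.suc) p pha)
... | false = filterᵇ-skip a (h ∘ F.suc) p pha

moves-unvisited : ∀ {m} (G : Graph m) vis v {w} → w ∈ moves G vis v → vis w ≡ false
moves-unvisited G vis v w∈ =
  Equivalence.to T-not-≡
    (proj₂ (Equivalence.to T-∧ (∈-filterᵇ⁻ (λ u → adj G v u ∧ not (vis u)) {l = allFin _} w∈)))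

mark-false : ∀ {m} {w u : Fin m} vis → mark w vis u ≡ false → u ≢ w × vis u ≡ false
mark-false {w = w} {u} vis e with u ≟ w
... | no u≢w = u≢w , e
... | yes _  with () ← e

moves-mark-[] : ∀ {m} (G : Graph m) vis v w → moves G vis v ≡ [] → moves G (mark w vis) v ≡ []
moves-mark-[] {m} G vis v w = filterᵇ-[]-mono _ _ fewer (allFin m)
  where
  fewer : ∀ u → T (adj G v u ∧ not (mark w vis u)) → T (adj G v u ∧ not (vis u))
  fewer u with adj G v u | does (u ≟ w) | vis u
  ... | true  | false | false = λ t → t
  ... | true  | false | true  = λ ()
  ... | true  | true  | _     = λ ()
  ... | false | _     | _     = λ ()

module Game {m : ℕ} (G : Graph m) (f : Payoff) where

  afterAlice : ℕ → Visited m → Fin m → ℕ → ℕ → Fin m → ℚ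
  afterAlice k vis pb A B w = val G f k bob (mark w vis) w pb (suc A) B

  afterBob : ℕ → Visited m → Fin m → ℕ → ℕ → Fin m → ℚ
  afterBob k vis pa A B w = val G f k alice (mark w vis) pa w A (suc B)

  step : ℕ → Turn → Visited m → Fin m → Fin m → ℕ → ℕ → List (Fin m) → List (Fin m) → ℚ
  step k alice vis pa pb A B (w ∷ ws) _        = minOver (afterAlice k vis pb A B) (w ∷ ws)
  step k alice vis pa pb A B []       (w ∷ ws) = maxOver (afterBob k vis pa A B) (w ∷ ws)
  step k bob   vis pa pb A B _        (w ∷ ws) = maxOver (afterBob k vis pa A B) (w ∷ ws)
  step k bob   vis pa pb A B (w ∷ ws) []       = minOver (afterAlice k vis pb A B) (w ∷ ws)
  step k _     vis pa pb A B []       []       = f A B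

  val-step : ∀ k t vis pa pb A B →
             val G f (suc k) t vis pa pb A B ≡ step k t vis pa pb A B (moves G vis pa) (moves G vis pb)
  val-step k t vis pa pb A B with moves G vis pa | moves G vis pb
  val-step k alice vis pa pb A B | w ∷ ws | _      = refl
  val-step k alice vis pa pb A B | []     | w ∷ ws = refl
  val-step k alice vis pa pb A B | []     | []     = refl
  val-step k bob   vis pa pb A B | _      | w ∷ ws = refl
  val-step k bob   vis pa pb A B | w ∷ ws | []     = refl
  val-step k bob   vis pa pb A B | []     | []     = refl

  -- The value is the payoff of some play, so any property of all payoffs with
  -- positive counts holds of it.
  val-invariant : (P : ℚ → Set) → (∀ A B → P (f (suc A) (suc B))) →
                  ∀ k t vis pa pb A B → P (val G f k t vis pa pb (suc A) (suc B))
  val-invariant P Pf zero    t vis pa pb A B = Pf A B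
  val-invariant P Pf (suc k) t vis pa pb A B
    rewrite val-step k t vis pa pb (suc A) (suc B) = go t (moves G vis pa) (moves G vis pb)
    where
    byAlice : ∀ w ws → P (minOver (afterAlice k vis pb (suc A) (suc B)) (w ∷ ws))
    byAlice = foldOver-closed ⊓-sel P _ (λ w → val-invariant P Pf k bob (mark w vis) w pb (suc A) B)
    byBob : ∀ w ws → P (maxOver (afterBob k vis pa (suc A) (suc B)) (w ∷ ws))
    byBob = foldOver-closed ⊔-sel P _ (λ w → val-invariant P Pf k alice (mark w vis) pa w A (suc B))
    go : ∀ t l₁ l₂ → P (step k t vis pa pb (suc A) (suc B) l₁ l₂)
    go alice (w ∷ ws) _        = byAlice w ws
    go alice []       (w ∷ ws) = byBob w ws
    go bob   _        (w ∷ ws) = byBob w ws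
    go bob   (w ∷ ws) []       = byAlice w ws
    go alice []       []       = Pf A B
    go bob   []       []       = Pf A B

val-positive : ∀ {m} (G : Graph m) k t vis pa pb A B → 0ℚ < val G B/A k t vis pa pb (suc A) (suc B)
val-positive G = Game.val-invariant G B/A (0ℚ <_) (λ A B → frac-positive B A)

playFrom-positive : ∀ {m} (G : Graph m) a b → 0ℚ < playFrom G B/A a b
playFrom-positive {m} G a b = val-positive G m alice _ a b 0 0

-- If Alice is stuck while 𝒜 = 1, she stays stuck, so the outcome is ℬ/1 ≥ 1.
alice-stuck : ∀ {m} (G : Graph m) k t vis pa pb B →
              moves G vis pa ≡ [] → 1ℚ ≤ val G B/A k t vis pa pb 1 (suc B)
alice-stuck G zero    t vis pa pb B stuck = one≤frac B
alice-stuck G (suc k) t vis pa pb B stuck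
  rewrite Game.val-step G B/A k t vis pa pb 1 (suc B) | stuck = go t (moves G vis pb)
  where
  byBob : ∀ w ws → 1ℚ ≤ maxOver (Game.afterBob G B/A k vis pa 1 (suc B)) (w ∷ ws)
  byBob w ws = ≤-trans (alice-stuck G k alice (mark w vis) pa w (suc B) (moves-mark-[] G vis pa w stuck))
                       (maxOver-upper (Game.afterBob G B/A k vis pa 1 (suc B)) (w ∷ ws) (here refl))
  go : ∀ t l₂ → 1ℚ ≤ Game.step G B/A k t vis pa pb 1 (suc B) [] l₂
  go alice (w ∷ ws) = byBob w ws
  go bob   (w ∷ ws) = byBob w ws
  go alice []       = one≤frac B
  go bob   []       = one≤frac B

swapTurn : Turn → Turn
swapTurn alice = bob
swapTurn bob   = alice

module Deletion {m : ℕ} (G : Graph (suc m)) (a : Fin (suc m)) where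

  H : Graph m
  H = deleteVertex G a

  ι : Fin m → Fin (suc m)
  ι = punchIn a

  ι-≟ : ∀ i j → does (ι i ≟ ι j) ≡ does (i ≟ j)
  ι-≟ i j with i ≟ j
  ... | yes refl = dec-true (ι i ≟ ι i) refl
  ... | no i≢j   = dec-false (ι i ≟ ι j) (i≢j ∘ punchIn-injective a i j)

  ι-≢-a : ∀ i → does (ι i ≟ a) ≡ false
  ι-≢-a i = dec-false (ι i ≟ a) (punchInᵢ≢i a i)

  -- A G-visited set and an H-visited set describe the same game state when
  -- they agree on the vertices of H and a is visited in G.
  record Agree (visG : Visited (suc m)) (visH : Visited m) : Set where
    constructor agree
    field
      onH       : ∀ i → visG (ι i) ≡ visH i
      a-visited : visG a ≡ true

  mark-agree : ∀ {visG visH} → Agree visG visH → ∀ w → Agree (mark (ι w) visG) (mark w visH)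
  mark-agree (agree onH a-visited) w =
    agree (λ i → cong₂ _∨_ (ι-≟ i w) (onH i))
          (trans (cong (does (a ≟ ι w) ∨_) a-visited) (∨-zeroʳ _))

  moves-ι : ∀ {visG visH} → Agree visG visH → ∀ x →
            moves G visG (ι x) ≡ map ι (moves H visH x)
  moves-ι {visG} {visH} (agree onH a-visited) x = begin
    filterᵇ legal (tabulate (λ u → u))         ≡⟨ filterᵇ-skip a (λ u → u) legal a-illegal ⟩
    filterᵇ legal (tabulate ι)                 ≡⟨ cong (filterᵇ legal) (sym (map-tabulate (λ u → u) ι)) ⟩
    filterᵇ legal (map ι (allFin m))           ≡⟨ filterᵇ-map legal ι (allFin m) ⟩
    map ι (filterᵇ (legal ∘ ι) (allFin m))     ≡⟨ cong (map ι) (filterᵇ-cong legalH (allFin m)) ⟩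
    map ι (moves H visH x)                     ∎
    where
    open ≡-Reasoning
    legal : Fin (suc m) → Bool
    legal w = adj G (ι x) w ∧ not (visG w)
    a-illegal : legal a ≡ false
    a-illegal rewrite a-visited with adj G (ι x) a
    ... | true  = refl
    ... | false = refl
    legalH : ∀ i → legal (ι i) ≡ adj H x i ∧ not (visH i)
    legalH i = cong (λ b → adj G (ι x) (ι i) ∧ not b) (onH i)

  -- The H-game for (ℬ+1)/𝒜 is the reciprocal of the G-game for ℬ/𝒜 with the
  -- roles exchanged: H-Alice (count 1+A) is G-Bob, and H-Bob (count B) is G-Alice,
  -- whose count 1+B also includes the deleted vertex a.
  deletion-duality : ∀ k t visG visH x y A B → Agree visG visH →
    val H [B+1]/A k t visH x y (suc A) B ≡
    recip (val G B/A k (swapTurn t) visG (ι y) (ι x) (suc B) (suc A))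
  deletion-duality zero    t visG visH x y A B R = sym (recip-frac (suc A) B)
  deletion-duality (suc k) t visG visH x y A B R = begin
    val H [B+1]/A (suc k) t visH x y (suc A) B
      ≡⟨ Game.val-step H [B+1]/A k t visH x y (suc A) B ⟩
    Game.step H [B+1]/A k t visH x y (suc A) B (moves H visH x) (moves H visH y)
      ≡⟨ dual-step t (moves H visH x) (moves H visH y) ⟩
    recip (stepG (swapTurn t) (map ι (moves H visH y)) (map ι (moves H visH x)))
      ≡⟨ cong recip (sym (cong₂ (stepG (swapTurn t)) (moves-ι R y) (moves-ι R x))) ⟩
    recip (stepG (swapTurn t) (moves G visG (ι y)) (moves G visG (ι x)))
      ≡⟨ cong recip (sym (Game.val-step G B/A k (swapTurn t) visG (ι y) (ι x) (suc B) (suc A))) ⟩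
    recip (val G B/A (suc k) (swapTurn t) visG (ι y) (ι x) (suc B) (suc A)) ∎
    where
    open ≡-Reasoning
    stepG : Turn → List (Fin (suc m)) → List (Fin (suc m)) → ℚ
    stepG t = Game.step G B/A k t visG (ι y) (ι x) (suc B) (suc A)
    aliceMoves : ∀ w ws → minOver (Game.afterAlice H [B+1]/A k visH y (suc A) B) (w ∷ ws) ≡
                 recip (maxOver (Game.afterBob G B/A k visG (ι y) (suc B) (suc A)) (map ι (w ∷ ws)))
    aliceMoves w ws = sym (begin
      recip (foldOver _⊔_ afterBobG (ι w) (map ι ws))
        ≡⟨ cong recip (foldOver-map _⊔_ afterBobG ι w ws) ⟩
      recip (maxOver (afterBobG ∘ ι) (w ∷ ws))
        ≡⟨ recip-maxOver (afterBobG ∘ ι) (λ z → val-positive G k alice _ (ι y) (ι z) B (suc A)) w ws ⟩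
      minOver (recip ∘ afterBobG ∘ ι) (w ∷ ws)
        ≡⟨ foldOver-cong _⊓_ _ _ (λ z → sym (deletion-duality k bob _ _ z y (suc A) B (mark-agree R z))) w ws ⟩
      minOver (Game.afterAlice H [B+1]/A k visH y (suc A) B) (w ∷ ws) ∎)
      where
      afterBobG : Fin (suc m) → ℚ
      afterBobG = Game.afterBob G B/A k visG (ι y) (suc B) (suc A)
    bobMoves : ∀ w ws → maxOver (Game.afterBob H [B+1]/A k visH x (suc A) B) (w ∷ ws) ≡
               recip (minOver (Game.afterAlice G B/A k visG (ι x) (suc B) (suc A)) (map ι (w ∷ ws)))
    bobMoves w ws = sym (begin
      recip (foldOver _⊓_ afterAliceG (ι w) (map ι ws))
        ≡⟨ cong recip (foldOver-map _⊓_ afterAliceG ι w ws) ⟩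
      recip (minOver (afterAliceG ∘ ι) (w ∷ ws))
        ≡⟨ recip-minOver (afterAliceG ∘ ι) (λ z → val-positive G k bob _ (ι z) (ι x) (suc B) A) w ws ⟩
      maxOver (recip ∘ afterAliceG ∘ ι) (w ∷ ws)
        ≡⟨ foldOver-cong _⊔_ _ _ (λ z → sym (deletion-duality k alice _ _ x z A (suc B) (mark-agree R z))) w ws ⟩
      maxOver (Game.afterBob H [B+1]/A k visH x (suc A) B) (w ∷ ws) ∎)
      where
      afterAliceG : Fin (suc m) → ℚ
      afterAliceG = Game.afterAlice G B/A k visG (ι x) (suc B) (suc A)
    dual-step : ∀ t l₁ l₂ → Game.step H [B+1]/A k t visH x y (suc A) B l₁ l₂ ≡
                recip (stepG (swapTurn t) (map ι l₂) (map ι l₁))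
    dual-step alice (w ∷ ws) _        = aliceMoves w ws
    dual-step alice []       (w ∷ ws) = bobMoves w ws
    dual-step bob   _        (w ∷ ws) = bobMoves w ws
    dual-step bob   (w ∷ ws) []       = aliceMoves w ws
    dual-step alice []       []       = sym (recip-frac (suc A) B)
    dual-step bob   []       []       = sym (recip-frac (suc A) B)

  vis₀ : Fin m → Visited (suc m)
  vis₀ x = mark a (mark (ι x) (λ _ → false))

  start-agree : ∀ x y → Agree (mark (ι y) (vis₀ x)) (mark x (mark y (λ _ → false)))
  start-agree x y = agree onH a-visited
    where
    onH : ∀ i → mark (ι y) (vis₀ x) (ι i) ≡ mark x (mark y (λ _ → false)) i
    onH i rewrite ι-≟ i y | ι-≢-a i | ι-≟ i x with does (i ≟ x) | does (i ≟ y)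
    ... | true  | true  = refl
    ... | true  | false = refl
    ... | false | true  = refl
    ... | false | false = refl
    a-visited : mark (ι y) (vis₀ x) a ≡ true
    a-visited rewrite dec-true (a ≟ a) refl = ∨-zeroʳ _

  alice-reply : ∀ x w ws → moves G (vis₀ x) a ≡ w ∷ ws →
                ∃[ y ] y ≢ x × playFrom H [B+1]/A x y ≡ recip (playFrom G B/A a (ι x))
  alice-reply x w ws moves≡ with foldOver-attained ⊓-sel (Game.afterAlice G B/A m (vis₀ x) (ι x) 1 1) w ws
  ... | z , z∈ws , min≡z = y , y≢x , duality
    where
    afterAlice : Fin (suc m) → ℚ
    afterAlice = Game.afterAlice G B/A m (vis₀ x) (ι x) 1 1
    alice-best : playFrom G B/A a (ι x) ≡ afterAlice z
    alice-best = trans (Game.val-step G B/A m alice (vis₀ x) a (ι x) 1 1)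
                   (trans (cong (λ l → Game.step G B/A m alice (vis₀ x) a (ι x) 1 1 l (moves G (vis₀ x) (ι x)))
                                moves≡)
                          min≡z)
    -- z is a legal move, hence neither a nor Bob's vertex ι x.
    z-unvisited : z ≢ a × mark (ι x) (λ _ → false) z ≡ false
    z-unvisited = mark-false (mark (ι x) (λ _ → false))
                    (moves-unvisited G (vis₀ x) a (subst (z ∈_) (sym moves≡) z∈ws))
    y : Fin m
    y = punchOut (proj₁ z-unvisited ∘ sym)
    ιy≡z : ι y ≡ z
    ιy≡z = punchIn-punchOut (proj₁ z-unvisited ∘ sym)
    y≢x : y ≢ x
    y≢x y≡x = proj₁ (mark-false (λ _ → false) (proj₂ z-unvisited)) (trans (sym ιy≡z) (cong ι y≡x))
    duality : playFrom H [B+1]/A x y ≡ recip (playFrom G B/A a (ι x))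
    duality = begin
      playFrom H [B+1]/A x y         ≡⟨ deletion-duality m alice _ _ x y 0 1 (start-agree x y) ⟩
      recip (afterAlice (ι y))       ≡⟨ cong (recip ∘ afterAlice) ιy≡z ⟩
      recip (afterAlice z)           ≡⟨ cong recip (sym alice-best) ⟩
      recip (playFrom G B/A a (ι x)) ∎
      where open ≡-Reasoning

  first-move : ∀ x → 1ℚ ≤ playFrom G B/A a (ι x) ⊎
                     ∃[ y ] y ≢ x × playFrom H [B+1]/A x y ≡ recip (playFrom G B/A a (ι x))
  first-move x = by-cases (moves G (vis₀ x) a) refl
    where
    by-cases : ∀ l → moves G (vis₀ x) a ≡ l → 1ℚ ≤ playFrom G B/A a (ι x) ⊎
               ∃[ y ] y ≢ x × playFrom H [B+1]/A x y ≡ recip (playFrom G B/A a (ι x))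
    by-cases []       stuck  = inj₁ (alice-stuck G (suc m) alice (vis₀ x) a (ι x) 0 stuck)
    by-cases (w ∷ ws) moves≡ = inj₂ (alice-reply x w ws moves≡)

startValue-upper : ∀ {m} (G : Graph m) f a {b} → b ≢ a → playFrom G f a b ≤ startValue G f a
startValue-upper G f a {b} b≢a =
  maxOver-upper (playFrom G f a) _
    (∈-filterᵇ⁺ (λ u → not (does (u ≟ a))) (∈-allFin b) (cong not (dec-false (b ≟ a) b≢a)))

rational-start : ∀ {m} (G : Graph (suc m)) f a → RationalAliceStart G f a →
                 startValue G f a ≤ gameValue G f
rational-start G f a optimal with foldOver-attained ⊓-sel (startValue G f) F.zero (tabulate F.suc)
... | z , _ , value≡z = subst (startValue G f a ≤_) (sym value≡z) (optimal z)

gameValue-lower : ∀ {m} (G : Graph (suc m)) f {c} → (∀ x → c ≤ startValue G f x) → c ≤ gameValue G f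
gameValue-lower G f c≤start = minOver-greatest (startValue G f) c≤start F.zero (tabulate F.suc)

lemma2 : ∀ {n} (G : Graph (suc (suc n))) (a : Fin (suc (suc n))) →
         gameValue G B/A < 1ℚ →
         RationalAliceStart G B/A a →
         recip (gameValue G B/A) ≤ gameValue (deleteVertex G a) [B+1]/A
lemma2 G a value<1 optimal = gameValue-lower H [B+1]/A bound
  where
  open Deletion G a
  -- As a is a rational start, no start ι x of Bob yields more than the game value.
  bob-start : ∀ x → playFrom G B/A a (ι x) ≤ gameValue G B/A
  bob-start x = ≤-trans (startValue-upper G B/A a (punchInᵢ≢i a x)) (rational-start G B/A a optimal)
  bound : ∀ x → recip (gameValue G B/A) ≤ startValue H [B+1]/A x
  bound x with first-move x
  ... | inj₁ 1≤value = ⊥-elim (<-irrefl refl (≤-<-trans (≤-trans 1≤value (bob-start x)) value<1))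
  ... | inj₂ (y , y≢x , duality) = begin
    recip (gameValue G B/A)        ≤⟨ recip-antitone (playFrom-positive G a (ι x)) (bob-start x) ⟩
    recip (playFrom G B/A a (ι x)) ≡⟨ duality ⟨
    playFrom H [B+1]/A x y         ≤⟨ startValue-upper H [B+1]/A x y≢x ⟩
    startValue H [B+1]/A x         ∎
    where open ≤-Reasoning
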